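{- For all integers $m\ge1$ and $0\le j\le m$, \[ (B^2)_{(t_m+j)} \;=\; \bigodot_{i=1}^{j}(B^{2m-i-j+2}B)^2\circ\bigodot_{i=j+1}^{m}(B^{m-i}B)^2 \] holds up to $\beta\eta$-equivalence, where $t_m=\frac{m^2+m}{2}$.
   Context: $B=\lambda f.\lambda g.\lambda x.\, f\,(g\,x)$; $B$-terms are combinatory terms built from $B$ by application, compared up to $\beta\eta$-equivalence of their $\lambda$-terms. $e_1\circ e_2$ denotes $B\,e_1\,e_2$ (associative up to equivalence); for a $B$-term $e$, $e^2=e\circ e$; in particular $B^2=B\circ B=B\,B\,B$. $B^0B=B$, $B^{n+1}B=B\,(B^nB)$. For a term $X$ and $k\ge1$, $X_{(k)}$ denotes $X\,X\cdots X$ ($k$ copies, application associated to the left). $\bigodot_{i=k}^{n}f_i$ denotes $f_k\circ f_{k+1}\circ\cdots\circ f_n$, and is omitted (the identity) when $k>n$. -}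

module Defs where

open import Data.Nat using (ℕ; zero; suc; _+_; _*_; _∸_; _<ᵇ_; _≡ᵇ_)
open import Data.Nat.DivMod using (_/_)
open import Data.Bool using (if_then_else_)
open import Data.List using (List; []; _∷_; _++_; applyUpTo)
open import Data.Maybe using (Maybe; just; nothing; maybe)

data Tm : Set where
  var : ℕ → Tm
  lam : Tm → Tm
  app : Tm → Tm → Tm

shift : ℕ → Tm → Tm
shift c (var x) = if x <ᵇ c then var x else var (suc x)
shift c (lam t) = lam (shift (suc c) t)
shift c (app t u) = app (shift c t) (shift c u)

sub : ℕ → Tm → Tm → Tm
sub k u (var x) =
  if x <ᵇ k then var x else (if x ≡ᵇ k then u else var (x ∸ 1))
sub k u (lam t) = lam (sub (suc k) (shift 0 u) t)
sub k u (app t s) = app (sub k u t) (sub k u s)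

infix 4 _≈βη_
data _≈βη_ : Tm → Tm → Set where
  β     : ∀ t u → app (lam t) u ≈βη sub 0 u t
  η     : ∀ t → lam (app (shift 0 t) (var 0)) ≈βη t
  ≈refl  : ∀ {t} → t ≈βη t
  ≈sym   : ∀ {t u} → t ≈βη u → u ≈βη t
  ≈trans : ∀ {t u v} → t ≈βη u → u ≈βη v → t ≈βη v
  lam-cong : ∀ {t u} → t ≈βη u → lam t ≈βη lam u
  app-cong : ∀ {t t′ u u′} → t ≈βη t′ → u ≈βη u′ → app t u ≈βη app t′ u′

data BTerm : Set where
  B   : BTerm
  _·_ : BTerm → BTerm → BTerm

infixl 9 _·_

-- B = λf.λg.λx. f (g x)
⟦_⟧ : BTerm → Tm
⟦ B ⟧ = lam (lam (lam (app (var 2) (app (var 1) (var 0)))))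
⟦ e · e′ ⟧ = app ⟦ e ⟧ ⟦ e′ ⟧

infix 4 _≈_
_≈_ : BTerm → BTerm → Set
e ≈ e′ = ⟦ e ⟧ ≈βη ⟦ e′ ⟧

infixr 8 _∘_
_∘_ : BTerm → BTerm → BTerm
e₁ ∘ e₂ = B · e₁ · e₂

_² : BTerm → BTerm
e ² = e ∘ e

B² : BTerm
B² = B ²

B^_B : ℕ → BTerm
B^ zero B = B
B^ suc n B = B · (B^ n B)

-- X₍ₖ₎ = X X ⋯ X (k copies, left-associated), for k ≥ 1; X₍₀₎ is never used
_₍_₎ : BTerm → ℕ → BTerm
X ₍ zero ₎ = X
X ₍ suc zero ₎ = X
X ₍ suc (suc k) ₎ = (X ₍ suc k ₎) · X

-- composition of a list of factors f₁ ∘ f₂ ∘ ⋯ ∘ fₙ (right-associated);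
-- nothing for the empty list (an empty composition is omitted)
⨀ : List BTerm → Maybe BTerm
⨀ [] = nothing
⨀ (x ∷ xs) = just (maybe (λ r → x ∘ r) x (⨀ xs))

t : ℕ → ℕ
t m = (m * m + m) / 2

-- the factors  (B^{2m-i-j+2}B)² for i = 1..j,  then (B^{m-i}B)² for i = j+1..m
factors : ℕ → ℕ → List BTerm
factors m j =
  applyUpTo (λ k → (B^ ((2 * m + 2) ∸ (suc k + j)) B) ²) j
  ++ applyUpTo (λ k → (B^ (m ∸ (j + suc k)) B) ²) (m ∸ j)

-- Write pₙ = (BⁿB)², so that B² = p₀ and (B²)₍ₖ₊₁₎ = (B²)₍ₖ₎ p₀. Two combinator
-- identities drive the proof: pₙ₊₁ w = pₙ ∘ w, and p_q ∘ p_r = p_{r+2} ∘ p_q for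
-- q < r. Hence applying a composite of pₙ's to p₀ lowers every exponent by one
-- and appends p₀; if the composite ended in p₀, the two copies merge into
-- p₂ = p₀ p₀, which commutes leftwards through the run p_{d-1} ∘ ⋯ ∘ p₀ and
-- emerges as p_{2d+2}. One such step takes the composite for (m, j) to the one
-- for (m, j + 1), and for j = m to the one for (m + 1, 0), matching
-- t_{m+1} = t_m + m + 1.
module Submission where

open import Data.Bool using (true; false)
open import Data.List using (List; []; _∷_; _++_; map; length; applyUpTo)
open import Data.List.Properties using (map-++; ++-identityʳ; length-++; length-applyUpTo)
open import Data.Maybe using (just; maybe)
open import Data.Nat using (ℕ; zero; suc; _+_; _*_; _∸_; _≤_; _<_; _<ᵇ_; _≡ᵇ_; z≤n; s≤s; z<s)
open import Data.Nat.Divisibility using (divides)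
open import Data.Nat.DivMod using (_/_; /-congˡ; +-distrib-/-∣ʳ; m*n/n≡m)
open import Data.Nat.Properties
  using (+-suc; +-comm; +-identityʳ; *-suc; ≤-trans; m≤m+n; m≤n+m; +-mono-<-≤;
         m+n∸m≡n; m+[n∸m]≡n; [m+n]∸[m+o]≡n∸o)
open import Data.Nat.Tactic.RingSolver using (solve-∀)
open import Data.Product using (∃-syntax; _×_; _,_)
open import Level using (0ℓ)
open import Relation.Binary.Bundles using (Setoid)
open import Relation.Binary.PropositionalEquality
import Relation.Binary.Reasoning.Setoid as SetoidReasoning

open import Defs

≈βη-setoid : Setoid 0ℓ 0ℓ
≈βη-setoid = record
  { Carrier       = Tm
  ; _≈_           = _≈βη_
  ; isEquivalence = record { refl = ≈refl ; sym = ≈sym ; trans = ≈trans }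
  }

module ≈-Reasoning = SetoidReasoning ≈βη-setoid

≡⇒≈βη : ∀ {x y} → x ≡ y → x ≈βη y
≡⇒≈βη refl = ≈refl

<ᵇ-sucʳ : ∀ x k → (x <ᵇ k) ≡ true → (x <ᵇ suc k) ≡ true
<ᵇ-sucʳ x       zero    ()
<ᵇ-sucʳ zero    (suc k) _ = refl
<ᵇ-sucʳ (suc x) (suc k) e = <ᵇ-sucʳ x k e

≮ᵇ⇒suc≮ᵇ : ∀ x k → (x <ᵇ k) ≡ false → (suc x <ᵇ k) ≡ false
≮ᵇ⇒suc≮ᵇ x       zero    _  = refl
≮ᵇ⇒suc≮ᵇ zero    (suc k) ()
≮ᵇ⇒suc≮ᵇ (suc x) (suc k) e  = ≮ᵇ⇒suc≮ᵇ x k e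

≮ᵇ⇒suc≢ᵇ : ∀ x k → (x <ᵇ k) ≡ false → (suc x ≡ᵇ k) ≡ false
≮ᵇ⇒suc≢ᵇ x       zero    _  = refl
≮ᵇ⇒suc≢ᵇ zero    (suc k) ()
≮ᵇ⇒suc≢ᵇ (suc x) (suc k) e  = ≮ᵇ⇒suc≢ᵇ x k e

sub-shift : ∀ k u t → sub k u (shift k t) ≡ t
sub-shift k u (var x) with x <ᵇ k in e
... | true  rewrite e = refl
... | false rewrite ≮ᵇ⇒suc≮ᵇ x k e | ≮ᵇ⇒suc≢ᵇ x k e = refl
sub-shift k u (lam t)   = cong lam (sub-shift (suc k) (shift 0 u) t)
sub-shift k u (app t s) = cong₂ app (sub-shift k u t) (sub-shift k u s)

sub-suc-shift-shift : ∀ k u t → sub (suc k) u (shift k (shift k t)) ≡ shift k t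
sub-suc-shift-shift k u (var x) with x <ᵇ k in e
... | true  rewrite e | <ᵇ-sucʳ x k e = refl
... | false rewrite ≮ᵇ⇒suc≮ᵇ x k e | ≮ᵇ⇒suc≢ᵇ x k e | ≮ᵇ⇒suc≮ᵇ x k e = refl
sub-suc-shift-shift k u (lam t)   = cong lam (sub-suc-shift-shift (suc k) (shift 0 u) t)
sub-suc-shift-shift k u (app t s) =
  cong₂ app (sub-suc-shift-shift k u t) (sub-suc-shift-shift k u s)

η-ext : ∀ t u → app (shift 0 t) (var 0) ≈βη app (shift 0 u) (var 0) → t ≈βη u
η-ext t u tv≈uv = ≈trans (≈sym (η t)) (≈trans (lam-cong tv≈uv) (η u))

Ι : Tm
Ι = lam (var 0)

Ι-β : ∀ x → app Ι x ≈βη x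
Ι-β x = β (var 0) x

infixr 8 _⊚_
_⊚_ : Tm → Tm → Tm
x ⊚ y = app (app ⟦ B ⟧ x) y

⊚-cong : ∀ {x x′ y y′} → x ≈βη x′ → y ≈βη y′ → x ⊚ y ≈βη x′ ⊚ y′
⊚-cong x≈x′ y≈y′ = app-cong (app-cong ≈refl x≈x′) y≈y′

⊚-β : ∀ x y z → app (x ⊚ y) z ≈βη app x (app y z)
⊚-β x y z =
  ≈trans (app-cong (app-cong (β _ x) ≈refl) ≈refl)
  (≈trans (app-cong (β _ y) ≈refl)
  (≈trans (β _ z)
  (≡⇒≈βη (cong₂ (λ x′ y′ → app x′ (app y′ z)) sub-x (sub-shift 0 z y)))))
  where
  sub-x : sub 0 z (sub 1 (shift 0 y) (shift 0 (shift 0 x))) ≡ x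
  sub-x = trans (cong (sub 0 z) (sub-suc-shift-shift 0 (shift 0 y) x)) (sub-shift 0 z x)

⊚-assoc : ∀ x y z → (x ⊚ y) ⊚ z ≈βη x ⊚ (y ⊚ z)
⊚-assoc x y z = η-ext _ _ (begin
  app ((x′ ⊚ y′) ⊚ z′) v     ≈⟨ ⊚-β _ _ _ ⟩
  app (x′ ⊚ y′) (app z′ v)   ≈⟨ ⊚-β _ _ _ ⟩
  app x′ (app y′ (app z′ v)) ≈⟨ app-cong ≈refl (⊚-β _ _ _) ⟨
  app x′ (app (y′ ⊚ z′) v)   ≈⟨ ⊚-β _ _ _ ⟨
  app (x′ ⊚ (y′ ⊚ z′)) v     ∎)
  where
  open ≈-Reasoning
  x′ = shift 0 x
  y′ = shift 0 y
  z′ = shift 0 z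
  v  = var 0

⊚-identityʳ : ∀ x → x ⊚ Ι ≈βη x
⊚-identityʳ x = η-ext _ _ (≈trans (⊚-β _ _ _) (app-cong ≈refl (Ι-β _)))

B-⊚-distrib : ∀ x y → app ⟦ B ⟧ (x ⊚ y) ≈βη app ⟦ B ⟧ x ⊚ app ⟦ B ⟧ y
B-⊚-distrib x y = η-ext _ _ (≈trans (⊚-assoc _ _ _) (≈sym (⊚-β _ _ _)))

B²-∘-B· : ∀ x → B² ∘ B · x ≈ B · (B · (B · x)) ∘ B²
B²-∘-B· x = η-ext _ _ (begin
  app (⟦ B² ⟧ ⊚ Bx′) v                            ≈⟨ ⊚-β _ _ _ ⟩
  app ⟦ B² ⟧ (x′ ⊚ v)                              ≈⟨ ⊚-β _ _ _ ⟩
  app ⟦ B ⟧ (app ⟦ B ⟧ (x′ ⊚ v))                   ≈⟨ app-cong ≈refl (B-⊚-distrib _ _) ⟩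
  app ⟦ B ⟧ (Bx′ ⊚ app ⟦ B ⟧ v)                    ≈⟨ B-⊚-distrib _ _ ⟩
  app ⟦ B ⟧ Bx′ ⊚ app ⟦ B ⟧ (app ⟦ B ⟧ v)          ≈⟨ app-cong ≈refl (⊚-β _ _ _) ⟨
  app (app ⟦ B ⟧ (app ⟦ B ⟧ Bx′)) (app ⟦ B² ⟧ v)   ≈⟨ ⊚-β _ _ _ ⟨
  app (app ⟦ B ⟧ (app ⟦ B ⟧ Bx′) ⊚ ⟦ B² ⟧) v       ∎)
  where
  open ≈-Reasoning
  x′  = shift 0 ⟦ x ⟧
  Bx′ = app ⟦ B ⟧ x′
  v   = var 0

P : ℕ → BTerm
P n = (B^ n B) ²

P-suc-app : ∀ a w → app ⟦ P (suc a) ⟧ w ≈βη ⟦ P a ⟧ ⊚ w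
P-suc-app a w = ≈trans (⊚-β _ _ _) (≈sym (⊚-assoc _ _ _))

B·P : ∀ a → B · P a ≈ P (suc a)
B·P a = B-⊚-distrib _ _

B·B·P : ∀ a → B · (B · P a) ≈ P (suc (suc a))
B·B·P a = ≈trans (app-cong ≈refl (B·P a)) (B·P (suc a))

B²·B² : B² · B² ≈ P 2
B²·B² = ≈trans (⊚-β _ _ _) (B·B·P 0)

P-∘-swap : ∀ {q r} → q < r → P q ∘ P r ≈ P (2 + r) ∘ P q
P-∘-swap {zero} {suc r} _ = begin
  ⟦ P 0 ⟧ ⊚ ⟦ P (suc r) ⟧                              ≈⟨ ⊚-cong ≈refl (B·P r) ⟨
  ⟦ P 0 ⟧ ⊚ app ⟦ B ⟧ ⟦ P r ⟧                          ≈⟨ B²-∘-B· (P r) ⟩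
  app ⟦ B ⟧ ⟦ B · (B · P r) ⟧ ⊚ ⟦ P 0 ⟧                ≈⟨ ⊚-cong (app-cong ≈refl (B·B·P r)) ≈refl ⟩
  app ⟦ B ⟧ ⟦ P (2 + r) ⟧ ⊚ ⟦ P 0 ⟧                    ≈⟨ ⊚-cong (B·P (2 + r)) ≈refl ⟩
  ⟦ P (3 + r) ⟧ ⊚ ⟦ P 0 ⟧                              ∎
  where open ≈-Reasoning
P-∘-swap {suc q} {suc r} (s≤s q<r) = begin
  ⟦ P (suc q) ⟧ ⊚ ⟦ P (suc r) ⟧                        ≈⟨ ⊚-cong (B·P q) (B·P r) ⟨
  app ⟦ B ⟧ ⟦ P q ⟧ ⊚ app ⟦ B ⟧ ⟦ P r ⟧                ≈⟨ B-⊚-distrib _ _ ⟨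
  app ⟦ B ⟧ (⟦ P q ⟧ ⊚ ⟦ P r ⟧)                        ≈⟨ app-cong ≈refl (P-∘-swap q<r) ⟩
  app ⟦ B ⟧ (⟦ P (2 + r) ⟧ ⊚ ⟦ P q ⟧)                  ≈⟨ B-⊚-distrib _ _ ⟩
  app ⟦ B ⟧ ⟦ P (2 + r) ⟧ ⊚ app ⟦ B ⟧ ⟦ P q ⟧          ≈⟨ ⊚-cong (B·P _) (B·P q) ⟩
  ⟦ P (3 + r) ⟧ ⊚ ⟦ P (suc q) ⟧                        ∎
  where open ≈-Reasoning

infixr 7 _⊚*_
_⊚*_ : List ℕ → Tm → Tm
[]      ⊚* w = w
(a ∷ l) ⊚* w = ⟦ P a ⟧ ⊚ (l ⊚* w)

⊚*-++ : ∀ l l′ w → (l ++ l′) ⊚* w ≡ l ⊚* (l′ ⊚* w)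
⊚*-++ []      l′ w = refl
⊚*-++ (a ∷ l) l′ w = cong (⟦ P a ⟧ ⊚_) (⊚*-++ l l′ w)

⊚*-cong : ∀ l {w w′} → w ≈βη w′ → l ⊚* w ≈βη l ⊚* w′
⊚*-cong []      w≈w′ = w≈w′
⊚*-cong (a ∷ l) w≈w′ = ⊚-cong ≈refl (⊚*-cong l w≈w′)

map-suc-⊚*-app : ∀ l w x → app (map suc l ⊚* w) x ≈βη l ⊚* app w x
map-suc-⊚*-app []      w x = ≈refl
map-suc-⊚*-app (a ∷ l) w x =
  ≈trans (⊚-β _ _ _) (≈trans (P-suc-app a _) (⊚-cong ≈refl (map-suc-⊚*-app l w x)))

⟦_⟧∘ : List BTerm → Tm
⟦ []     ⟧∘ = Ι
⟦ e ∷ es ⟧∘ = ⟦ e ⟧ ⊚ ⟦ es ⟧∘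

⟦map-P⟧∘ : ∀ l → ⟦ map P l ⟧∘ ≡ l ⊚* Ι
⟦map-P⟧∘ []      = refl
⟦map-P⟧∘ (a ∷ l) = cong (⟦ P a ⟧ ⊚_) (⟦map-P⟧∘ l)

⨀-sound : ∀ es → 1 ≤ length es → ∃[ e ] (⨀ es ≡ just e × ⟦ e ⟧ ≈βη ⟦ es ⟧∘)
⨀-sound (x ∷ [])     _ = x , refl , ≈sym (⊚-identityʳ _)
⨀-sound (x ∷ y ∷ ys) _ =
  let e , ⨀≡e , e≈ = ⨀-sound (y ∷ ys) (s≤s z≤n)
  in x ∘ e , cong (λ r → just (maybe (x ∘_) x r)) ⨀≡e , ⊚-cong ≈refl e≈

descend : ℕ → ℕ → List ℕ
descend s zero    = []
descend s (suc n) = s + n ∷ descend s n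

descend-suc : ∀ s n → descend (suc s) n ≡ map suc (descend s n)
descend-suc s zero    = refl
descend-suc s (suc n) = cong (suc (s + n) ∷_) (descend-suc s n)

descend-⊚* : ∀ s n w → descend s (suc n) ⊚* w ≡ descend (suc s) n ⊚* (⟦ P s ⟧ ⊚ w)
descend-⊚* s zero    w = cong (λ k → ⟦ P k ⟧ ⊚ w) (+-identityʳ s)
descend-⊚* s (suc n) w = cong₂ (λ k x → ⟦ P k ⟧ ⊚ x) (+-suc s n) (descend-⊚* s n w)

descend-⊚*-P : ∀ {s r} n w → s < r →
  descend s n ⊚* (⟦ P r ⟧ ⊚ w) ≈βη ⟦ P (2 * n + r) ⟧ ⊚ (descend s n ⊚* w)
descend-⊚*-P zero w s<r = ≈refl
descend-⊚*-P {s} {r} (suc n) w s<r = begin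
  ⟦ P (s + n) ⟧ ⊚ (descend s n ⊚* (⟦ P r ⟧ ⊚ w))
    ≈⟨ ⊚-cong ≈refl (descend-⊚*-P n w s<r) ⟩
  ⟦ P (s + n) ⟧ ⊚ (⟦ P (2 * n + r) ⟧ ⊚ rest)
    ≈⟨ ⊚-assoc _ _ _ ⟨
  (⟦ P (s + n) ⟧ ⊚ ⟦ P (2 * n + r) ⟧) ⊚ rest
    ≈⟨ ⊚-cong (P-∘-swap s+n<2n+r) ≈refl ⟩
  (⟦ P (2 + (2 * n + r)) ⟧ ⊚ ⟦ P (s + n) ⟧) ⊚ rest
    ≈⟨ ⊚-assoc _ _ _ ⟩
  ⟦ P (2 + 2 * n + r) ⟧ ⊚ (⟦ P (s + n) ⟧ ⊚ rest)
    ≡⟨ cong (λ k → ⟦ P (k + r) ⟧ ⊚ (⟦ P (s + n) ⟧ ⊚ rest)) (*-suc 2 n) ⟨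
  ⟦ P (2 * suc n + r) ⟧ ⊚ (⟦ P (s + n) ⟧ ⊚ rest)
    ∎
  where
  open ≈-Reasoning
  rest = descend s n ⊚* w
  s+n<2n+r : s + n < 2 * n + r
  s+n<2n+r = subst (s + n <_) (+-comm r (2 * n)) (+-mono-<-≤ s<r (m≤m+n n (n + 0)))

exponents : ℕ → ℕ → List ℕ
exponents j d = descend (2 * d + 2) j ++ descend 0 d

exponents-step : ∀ j d → app (exponents j (suc d) ⊚* Ι) ⟦ B² ⟧ ≈βη exponents (suc j) d ⊚* Ι
exponents-step j d = begin
  app (exponents j (suc d) ⊚* Ι) ⟦ B² ⟧
    ≡⟨ cong (λ x → app x ⟦ B² ⟧) (⊚*-++ (descend (2 * suc d + 2) j) (descend 0 (suc d)) Ι) ⟩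
  app (descend (2 * suc d + 2) j ⊚* (descend 0 (suc d) ⊚* Ι)) ⟦ B² ⟧
    ≡⟨ cong (λ x → app x ⟦ B² ⟧) (cong₂ _⊚*_ upper-shift (descend-⊚* 0 d Ι)) ⟩
  app (map suc upper ⊚* (descend 1 d ⊚* (⟦ P 0 ⟧ ⊚ Ι))) ⟦ B² ⟧
    ≡⟨ cong (λ x → app (map suc upper ⊚* (x ⊚* (⟦ P 0 ⟧ ⊚ Ι))) ⟦ B² ⟧) (descend-suc 0 d) ⟩
  app (map suc upper ⊚* (map suc lower ⊚* (⟦ P 0 ⟧ ⊚ Ι))) ⟦ B² ⟧
    ≡⟨ cong (λ x → app x ⟦ B² ⟧) (sym (⊚*-++ (map suc upper) (map suc lower) _)) ⟩
  app ((map suc upper ++ map suc lower) ⊚* (⟦ P 0 ⟧ ⊚ Ι)) ⟦ B² ⟧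
    ≡⟨ cong (λ l → app (l ⊚* (⟦ P 0 ⟧ ⊚ Ι)) ⟦ B² ⟧) (sym (map-++ suc upper lower)) ⟩
  app (map suc (upper ++ lower) ⊚* (⟦ P 0 ⟧ ⊚ Ι)) ⟦ B² ⟧
    ≈⟨ map-suc-⊚*-app (upper ++ lower) _ _ ⟩
  (upper ++ lower) ⊚* app (⟦ P 0 ⟧ ⊚ Ι) ⟦ B² ⟧
    ≈⟨ ⊚*-cong (upper ++ lower) B²-merge ⟩
  (upper ++ lower) ⊚* (⟦ P 2 ⟧ ⊚ Ι)
    ≡⟨ ⊚*-++ upper lower _ ⟩
  upper ⊚* (lower ⊚* (⟦ P 2 ⟧ ⊚ Ι))
    ≈⟨ ⊚*-cong upper (descend-⊚*-P d Ι z<s) ⟩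
  upper ⊚* (⟦ P (2 * d + 2) ⟧ ⊚ (lower ⊚* Ι))
    ≡⟨ descend-⊚* (2 * d + 2) j (lower ⊚* Ι) ⟨
  descend (2 * d + 2) (suc j) ⊚* (lower ⊚* Ι)
    ≡⟨ ⊚*-++ (descend (2 * d + 2) (suc j)) lower Ι ⟨
  exponents (suc j) d ⊚* Ι
    ∎
  where
  open ≈-Reasoning
  upper = descend (suc (2 * d + 2)) j
  lower = descend 0 d
  upper-shift : descend (2 * suc d + 2) j ≡ map suc upper
  upper-shift = trans (cong (λ k → descend (k + 2) j) (*-suc 2 d)) (descend-suc _ j)
  B²-merge : app (⟦ P 0 ⟧ ⊚ Ι) ⟦ B² ⟧ ≈βη ⟦ P 2 ⟧ ⊚ Ι
  B²-merge = ≈trans (⊚-β _ _ _)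
    (≈trans (app-cong ≈refl (Ι-β _)) (≈trans B²·B² (≈sym (⊚-identityʳ _))))

exponents-wrap : ∀ j → app (exponents (suc j) 0 ⊚* Ι) ⟦ B² ⟧ ≈βη exponents 0 (suc (suc j)) ⊚* Ι
exponents-wrap j = begin
  app (exponents (suc j) 0 ⊚* Ι) ⟦ B² ⟧
    ≡⟨ cong (λ l → app (l ⊚* Ι) ⟦ B² ⟧) (++-identityʳ _) ⟩
  app (descend 2 (suc j) ⊚* Ι) ⟦ B² ⟧
    ≡⟨ cong (λ l → app (l ⊚* Ι) ⟦ B² ⟧) (descend-suc 1 (suc j)) ⟩
  app (map suc (descend 1 (suc j)) ⊚* Ι) ⟦ B² ⟧
    ≈⟨ map-suc-⊚*-app (descend 1 (suc j)) Ι _ ⟩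
  descend 1 (suc j) ⊚* app Ι ⟦ B² ⟧
    ≈⟨ ⊚*-cong (descend 1 (suc j)) (≈trans (Ι-β _) (≈sym (⊚-identityʳ _))) ⟩
  descend 1 (suc j) ⊚* (⟦ P 0 ⟧ ⊚ Ι)
    ≡⟨ descend-⊚* 0 (suc j) Ι ⟨
  descend 0 (suc (suc j)) ⊚* Ι
    ∎
  where open ≈-Reasoning

t-suc : ∀ m → t (suc m) ≡ t m + suc m
t-suc m = begin
  (suc m * suc m + suc m) / 2          ≡⟨ /-congˡ (square-step m) ⟩
  ((m * m + m) + suc m * 2) / 2        ≡⟨ +-distrib-/-∣ʳ (m * m + m) (divides (suc m) refl) ⟩
  t m + suc m * 2 / 2                  ≡⟨ cong (t m +_) (m*n/n≡m (suc m) 2) ⟩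
  t m + suc m                          ∎
  where
  open ≡-Reasoning
  square-step : ∀ m → suc m * suc m + suc m ≡ (m * m + m) + suc m * 2
  square-step = solve-∀

1≤t : ∀ {m} → 1 ≤ m → 1 ≤ t m
1≤t {suc m} _ = subst (1 ≤_) (sym (t-suc m)) (≤-trans (s≤s z≤n) (m≤n+m (suc m) (t m)))

B²₍t+suc₎ : ∀ {m} k → 1 ≤ m → ⟦ B² ₍ t m + suc k ₎ ⟧ ≡ app ⟦ B² ₍ t m + k ₎ ⟧ ⟦ B² ⟧
B²₍t+suc₎ {m} k 1≤m rewrite +-suc (t m) k = iterate-suc (≤-trans (1≤t 1≤m) (m≤m+n (t m) k))
  where
  iterate-suc : ∀ {n} → 1 ≤ n → ⟦ B² ₍ suc n ₎ ⟧ ≡ app ⟦ B² ₍ n ₎ ⟧ ⟦ B² ⟧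
  iterate-suc {suc n} _ = refl

B²₍₎-exponents : ∀ m j d → 1 ≤ m → j + d ≡ m → ⟦ B² ₍ t m + j ₎ ⟧ ≈βη exponents j d ⊚* Ι
B²₍₎-exponents m (suc j) d 1≤m j+d≡m = begin
  ⟦ B² ₍ t m + suc j ₎ ⟧
    ≡⟨ B²₍t+suc₎ j 1≤m ⟩
  app ⟦ B² ₍ t m + j ₎ ⟧ ⟦ B² ⟧
    ≈⟨ app-cong (B²₍₎-exponents m j (suc d) 1≤m (trans (+-suc j d) j+d≡m)) ≈refl ⟩
  app (exponents j (suc d) ⊚* Ι) ⟦ B² ⟧
    ≈⟨ exponents-step j d ⟩
  exponents (suc j) d ⊚* Ι
    ∎
  where open ≈-Reasoning
B²₍₎-exponents (suc zero) zero .1 _ refl = ≈sym (⊚-identityʳ _)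
B²₍₎-exponents (suc (suc n)) zero .(suc (suc n)) _ refl = begin
  ⟦ B² ₍ t (2 + n) + 0 ₎ ⟧
    ≡⟨ cong (λ k → ⟦ B² ₍ k ₎ ⟧) index ⟩
  ⟦ B² ₍ t (suc n) + suc (suc n) ₎ ⟧
    ≡⟨ B²₍t+suc₎ {suc n} (suc n) (s≤s z≤n) ⟩
  app ⟦ B² ₍ t (suc n) + suc n ₎ ⟧ ⟦ B² ⟧
    ≈⟨ app-cong (B²₍₎-exponents (suc n) (suc n) 0 (s≤s z≤n) (+-identityʳ _)) ≈refl ⟩
  app (exponents (suc n) 0 ⊚* Ι) ⟦ B² ⟧
    ≈⟨ exponents-wrap n ⟩
  exponents 0 (suc (suc n)) ⊚* Ι
    ∎
  where
  open ≈-Reasoning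
  index : t (2 + n) + 0 ≡ t (suc n) + suc (suc n)
  index = trans (+-identityʳ _) (t-suc (suc n))

applyUpTo-descend : ∀ {A : Set} (f : ℕ → A) g s n → (∀ k → k < n → g k ≡ f (s + (n ∸ suc k))) →
  applyUpTo g n ≡ map f (descend s n)
applyUpTo-descend f g s zero    _  = refl
applyUpTo-descend f g s (suc n) g≡ =
  cong₂ _∷_ (g≡ 0 z<s) (applyUpTo-descend f (λ k → g (suc k)) s n (λ k k<n → g≡ (suc k) (s≤s k<n)))

∸-upper-exponent : ∀ i e d → (2 * ((i + e) + d) + 2) ∸ (i + (i + e)) ≡ (2 * d + 2) + e
∸-upper-exponent i e d =
  trans (cong (_∸ (i + (i + e))) (split i e d)) (m+n∸m≡n (i + (i + e)) _)
  where
  split : ∀ i e d → 2 * ((i + e) + d) + 2 ≡ (i + (i + e)) + ((2 * d + 2) + e)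
  split = solve-∀

factors≡map-P-exponents : ∀ j d → factors (j + d) j ≡ map P (exponents j d)
factors≡map-P-exponents j d =
  trans (cong₂ _++_ upper lower) (sym (map-++ P (descend (2 * d + 2) j) (descend 0 d)))
  where
  upper-exponent : ∀ k → k < j → (2 * (j + d) + 2) ∸ (suc k + j) ≡ (2 * d + 2) + (j ∸ suc k)
  upper-exponent k k<j =
    subst (λ J → (2 * (J + d) + 2) ∸ (suc k + J) ≡ (2 * d + 2) + (j ∸ suc k))
      (m+[n∸m]≡n k<j) (∸-upper-exponent (suc k) (j ∸ suc k) d)
  upper : applyUpTo (λ k → P ((2 * (j + d) + 2) ∸ (suc k + j))) j ≡ map P (descend (2 * d + 2) j)
  upper = applyUpTo-descend P _ (2 * d + 2) j λ k k<j → cong P (upper-exponent k k<j)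
  lower : applyUpTo (λ k → P ((j + d) ∸ (j + suc k))) ((j + d) ∸ j) ≡ map P (descend 0 d)
  lower = trans (cong (applyUpTo _) (m+n∸m≡n j d))
    (applyUpTo-descend P _ 0 d λ k _ → cong P ([m+n]∸[m+o]≡n∸o j d (suc k)))

lemma3p5 : ∀ (m j : ℕ) → 1 ≤ m → j ≤ m →
    ∃[ e ] (⨀ (factors m j) ≡ just e × B² ₍ t m + j ₎ ≈ e)
lemma3p5 m j 1≤m j≤m =
  let e , ⨀≡e , e≈factors = ⨀-sound (factors m j) (subst (1 ≤_) (sym length-factors) 1≤m)
  in e , ⨀≡e , (begin
    ⟦ B² ₍ t m + j ₎ ⟧            ≈⟨ B²₍₎-exponents m j d 1≤m j+d≡m ⟩
    exponents j d ⊚* Ι            ≡⟨ ⟦map-P⟧∘ (exponents j d) ⟨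
    ⟦ map P (exponents j d) ⟧∘    ≡⟨ cong ⟦_⟧∘ factors≡ ⟨
    ⟦ factors m j ⟧∘              ≈⟨ e≈factors ⟨
    ⟦ e ⟧                         ∎)
  where
  open ≈-Reasoning
  d = m ∸ j
  j+d≡m : j + d ≡ m
  j+d≡m = m+[n∸m]≡n j≤m
  factors≡ : factors m j ≡ map P (exponents j d)
  factors≡ = subst (λ n → factors n j ≡ map P (exponents j d)) j+d≡m (factors≡map-P-exponents j d)
  length-factors : length (factors m j) ≡ m
  length-factors = trans (length-++ (applyUpTo _ j))
    (trans (cong₂ _+_ (length-applyUpTo _ j) (length-applyUpTo _ d)) j+d≡m)
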